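{- Let $L$ be a finite join-semidistributive lattice and let $F$ be a set of join-irreducible elements of $L$ such that: $|F|\ge 3$; every proper subset of $F$ is a face of the canonical join complex of $L$; the join $\bigvee F$ is irredundant; and $F$ is not a face of the canonical join complex. Then there exists $j\in F$ such that $\kappa(j)$ does not exist.
   Context: A join $\bigvee A$ is irredundant if no proper subset has the same join; the canonical join representation of $w$ is the unique join-refinement-minimal irredundant $A$ with $\bigvee A=w$ ($A$ refines $B$ if each element of $A$ lies below some element of $B$). Join-semidistributive: $x\vee y=x\vee z\Rightarrow x\vee(y\wedge z)=x\vee y$. The canonical join complex has as faces the sets $A$ that are the canonical join representation of $\bigvee A$. For a join-irreducible $j$ (covering exactly one element $j_*$), $\mathcal{K}(j)=\{a\in L: a\ge j_*,\ a\not\ge j\}$, and $\kappa(j)$ denotes the unique maximal element of $\mathcal{K}(j)$ when such a unique maximal element exists. -}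

module Defs where

open import Level using (0ℓ)
open import Data.Nat using (ℕ)
open import Data.Fin using (Fin)
open import Data.Fin.Subset using (Subset; _∈_; _⊂_)
open import Data.Fin.Subset.Properties using (_∈?_)
open import Data.List using (List; filter; foldr; allFin)
open import Data.Product using (Σ; ∃; _×_; _,_)
open import Relation.Nullary using (¬_)
open import Data.Empty renaming (⊥ to Empty)
open import Relation.Binary using (Rel; Decidable)
open import Relation.Binary.PropositionalEquality using (_≡_; _≢_)
open import Relation.Binary.Lattice.Structures using (IsBoundedLattice)

-- A finite lattice, presented (up to isomorphism) on the carrier Fin n with
-- propositional equality.  Every finite (nonempty) lattice is bounded, and its
-- order is decidable (classically), so we record ⊤, ⊥ and decidability of ≤.
record FinLattice (n : ℕ) : Set₁ where
  field
    _≤_ : Rel (Fin n) 0ℓ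
    _∨_ : Fin n → Fin n → Fin n
    _∧_ : Fin n → Fin n → Fin n
    ⊤ : Fin n
    ⊥ : Fin n
    isBoundedLattice : IsBoundedLattice _≡_ _≤_ _∨_ _∧_ ⊤ ⊥
    _≤?_ : Decidable _≤_
  infix 4 _≤_
  infixr 6 _∨_
  infixr 7 _∧_

module _ {n : ℕ} (L : FinLattice n) where
  open FinLattice L

  _<_ : Fin n → Fin n → Set
  x < y = x ≤ y × x ≢ y

  JoinSemidistributive : Set
  JoinSemidistributive = ∀ x y z → x ∨ y ≡ x ∨ z → x ∨ (y ∧ z) ≡ x ∨ y

  joinList : List (Fin n) → Fin n
  joinList = foldr _∨_ ⊥

  ⋁ : Subset n → Fin n
  ⋁ A = joinList (filter (_∈? A) (allFin n))

  _⋖_ : Fin n → Fin n → Set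
  x ⋖ y = x < y × (∀ z → x < z → z < y → Empty)

  JoinIrreducible : Fin n → Set
  JoinIrreducible j = Σ (Fin n) λ j* → j* ⋖ j × (∀ y → y ⋖ j → y ≡ j*)

  Refines : Subset n → Subset n → Set
  Refines A B = ∀ a → a ∈ A → Σ (Fin n) λ b → b ∈ B × a ≤ b

  Irredundant : Subset n → Set
  Irredundant A = ∀ B → B ⊂ A → ⋁ B ≢ ⋁ A

  -- A is the join-refinement-minimal irredundant join representation of w,
  -- i.e. the unique minimal one; in the finite poset of irredundant join
  -- representations of w (ordered by refinement) this is: A refines all of them.
  IsCanonicalJoinRep : Fin n → Subset n → Set
  IsCanonicalJoinRep w A =
    ⋁ A ≡ w × Irredundant A × (∀ B → ⋁ B ≡ w → Irredundant B → Refines A B)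

  IsFace : Subset n → Set
  IsFace A = IsCanonicalJoinRep (⋁ A) A

  𝒦 : (j : Fin n) → JoinIrreducible j → Fin n → Set
  𝒦 j (j* , _) a = j* ≤ a × ¬ (j ≤ a)

  MaximalIn𝒦 : (j : Fin n) → JoinIrreducible j → Fin n → Set
  MaximalIn𝒦 j ji m = 𝒦 j ji m × (∀ a → 𝒦 j ji a → m ≤ a → a ≡ m)

  KappaExists : (j : Fin n) → JoinIrreducible j → Set
  KappaExists j ji =
    Σ (Fin n) λ m → MaximalIn𝒦 j ji m × (∀ m' → MaximalIn𝒦 j ji m' → m' ≡ m)

-- Suppose κ(j) exists for every j ∈ F, and put w = ⋁F.  Since every pair {j, j'} ⊆ F is a
-- proper subset of F, it is a face, and canonicity of the pair forces j ≰ j' ∨ j_*; so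
-- j' ∨ j_* ∈ 𝒦(j) and hence j' ≤ κ(j).  Thus w = (κ(j) ∧ w) ∨ j, and every element of the
-- interval [κ(j) ∧ w, w] is either w or below κ(j) ∧ w.  Given any B with ⋁B = w, pick
-- b ∈ B with b ≰ κ(j) ∧ w; then (κ(j) ∧ w) ∨ b = w, and join-semidistributivity gives
-- (κ(j) ∧ w) ∨ (j ∧ b) = w, which is only possible if j ≤ b.  So F refines every join
-- representation of w, i.e. F would be a face.
module Submission where

open import Defs
open import Data.Nat using (ℕ; _≥_)
open import Data.Fin.Subset using (Subset; _∈_; _⊂_; ∣_∣)
open import Data.Product using (Σ; _×_)
open import Relation.Nullary using (¬_)

open import Data.Nat as ℕ using (z≤n; s≤s; _+_)
open import Data.Nat.Properties using (+-suc; n≤1+n; +-monoʳ-≤)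
import Data.Nat.Properties as ℕₚ
open import Data.Fin using (Fin; _≟_)
open import Data.Fin.Subset using (⁅_⁆; _∪_; _⊆_; _∉_; inside; outside)
open import Data.Fin.Subset.Properties
  using (_∈?_; x∈⁅x⁆; x∈⁅y⁆⇒x≡y; x∈p∪q⁻; x∈p∪q⁺; q⊆p∪q; p⊆q⇒∣p∣≤∣q∣; ∣⁅x⁆∣≡1)
open import Data.Fin.Properties using (any?; all?)
open import Data.Fin.Induction using (po-noetherian)
open import Data.List using ([]; _∷_; allFin)
open import Data.List.Membership.Propositional using () renaming (_∈_ to _∈ₗ_)
open import Data.List.Membership.Propositional.Properties using (∈-filter⁺; ∈-filter⁻; ∈-allFin)
open import Data.List.Relation.Unary.Any using (here; there)
open import Data.Product using (∃; _,_; proj₁; proj₂)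
open import Data.Sum using (_⊎_; inj₁; inj₂; [_,_]′)
open import Data.Vec.Base using (_∷_; []) renaming (here to hereᵥ; there to thereᵥ)
open import Data.Empty using (⊥-elim)
open import Function using (_∘_)
open import Induction.WellFounded using (Acc; acc)
open import Relation.Nullary using (Dec; yes; no)
open import Relation.Nullary.Decidable using (_×-dec_; _→-dec_; ¬?; map′; decidable-stable)
open import Relation.Binary.PropositionalEquality
  using (_≡_; _≢_; refl; sym; trans; cong; cong₂; subst)
open import Relation.Binary.Lattice.Structures using (IsBoundedLattice)

∈-irrelevant : ∀ {n} {x : Fin n} {p : Subset n} (a b : x ∈ p) → a ≡ b
∈-irrelevant hereᵥ hereᵥ = refl
∈-irrelevant (thereᵥ a) (thereᵥ b) = cong thereᵥ (∈-irrelevant a b)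

∣p∪q∣≤∣p∣+∣q∣ : ∀ {n} (p q : Subset n) → ∣ p ∪ q ∣ ℕ.≤ ∣ p ∣ + ∣ q ∣
∣p∪q∣≤∣p∣+∣q∣ [] [] = z≤n
∣p∪q∣≤∣p∣+∣q∣ (inside ∷ p) (inside ∷ q) =
  s≤s (ℕₚ.≤-trans (∣p∪q∣≤∣p∣+∣q∣ p q) (+-monoʳ-≤ ∣ p ∣ (n≤1+n ∣ q ∣)))
∣p∪q∣≤∣p∣+∣q∣ (inside ∷ p) (outside ∷ q) = s≤s (∣p∪q∣≤∣p∣+∣q∣ p q)
∣p∪q∣≤∣p∣+∣q∣ (outside ∷ p) (inside ∷ q) =
  ℕₚ.≤-trans (s≤s (∣p∪q∣≤∣p∣+∣q∣ p q)) (ℕₚ.≤-reflexive (sym (+-suc ∣ p ∣ ∣ q ∣)))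
∣p∪q∣≤∣p∣+∣q∣ (outside ∷ p) (outside ∷ q) = ∣p∪q∣≤∣p∣+∣q∣ p q

module _ {n : ℕ} where

  ⁅x⁆∪⁅y⁆-elim : ∀ {p} (P : Fin n → Set p) {x y : Fin n} → P x → P y → ∀ {z} → z ∈ ⁅ x ⁆ ∪ ⁅ y ⁆ → P z
  ⁅x⁆∪⁅y⁆-elim P {x} {y} Px Py z∈ with x∈p∪q⁻ ⁅ x ⁆ ⁅ y ⁆ z∈
  ... | inj₁ z∈⁅x⁆ = subst P (sym (x∈⁅y⁆⇒x≡y x z∈⁅x⁆)) Px
  ... | inj₂ z∈⁅y⁆ = subst P (sym (x∈⁅y⁆⇒x≡y y z∈⁅y⁆)) Py

  x∈⁅x⁆∪⁅y⁆ : ∀ (x y : Fin n) → x ∈ ⁅ x ⁆ ∪ ⁅ y ⁆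
  x∈⁅x⁆∪⁅y⁆ x y = x∈p∪q⁺ (inj₁ (x∈⁅x⁆ x))

  y∈⁅x⁆∪⁅y⁆ : ∀ (x y : Fin n) → y ∈ ⁅ x ⁆ ∪ ⁅ y ⁆
  y∈⁅x⁆∪⁅y⁆ x y = x∈p∪q⁺ (inj₂ (x∈⁅x⁆ y))

  ∣⁅x⁆∪⁅y⁆∣≤2 : ∀ (x y : Fin n) → ∣ ⁅ x ⁆ ∪ ⁅ y ⁆ ∣ ℕ.≤ 2
  ∣⁅x⁆∪⁅y⁆∣≤2 x y = ℕₚ.≤-trans (∣p∪q∣≤∣p∣+∣q∣ ⁅ x ⁆ ⁅ y ⁆)
                              (ℕₚ.≤-reflexive (cong₂ _+_ (∣⁅x⁆∣≡1 x) (∣⁅x⁆∣≡1 y)))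

  ⁅x⁆∪⁅y⁆⊂ : ∀ {F : Subset n} {x y} → ∣ F ∣ ≥ 3 → x ∈ F → y ∈ F → ⁅ x ⁆ ∪ ⁅ y ⁆ ⊂ F
  ⁅x⁆∪⁅y⁆⊂ {F} {x} {y} 3≤∣F∣ x∈F y∈F with any? (λ k → (k ∈? F) ×-dec ¬? (k ∈? ⁅ x ⁆ ∪ ⁅ y ⁆))
  ... | yes (k , k∈F , k∉) = ⁅x⁆∪⁅y⁆-elim (_∈ F) x∈F y∈F , k , k∈F , k∉
  ... | no none = ⊥-elim (ℕₚ.<-irrefl refl (ℕₚ.≤-trans 3≤∣F∣ ∣F∣≤2))
    where
    F⊆⁅x⁆∪⁅y⁆ : F ⊆ ⁅ x ⁆ ∪ ⁅ y ⁆
    F⊆⁅x⁆∪⁅y⁆ {k} k∈F = decidable-stable (k ∈? ⁅ x ⁆ ∪ ⁅ y ⁆) (λ k∉ → none (k , k∈F , k∉))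
    ∣F∣≤2 : ∣ F ∣ ℕ.≤ 2
    ∣F∣≤2 = ℕₚ.≤-trans (p⊆q⇒∣p∣≤∣q∣ F⊆⁅x⁆∪⁅y⁆) (∣⁅x⁆∪⁅y⁆∣≤2 x y)

module FinLatticeProperties {n : ℕ} (L : FinLattice n) where
  open FinLattice L using (_≤_; _∨_; _∧_; _≤?_; isBoundedLattice)
  open IsBoundedLattice isBoundedLattice
    using (isPartialOrder; reflexive; antisym; minimum; x≤x∨y; y≤x∨y; ∨-least; x∧y≤x; x∧y≤y; ∧-greatest)
    renaming (refl to ≤-refl; trans to ≤-trans)

  x≤y⇒x∨y≡y : ∀ {x y} → x ≤ y → x ∨ y ≡ y
  x≤y⇒x∨y≡y {x} {y} x≤y = antisym (∨-least x≤y ≤-refl) (y≤x∨y x y)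

  joinList-upper : ∀ {x xs} → x ∈ₗ xs → x ≤ joinList L xs
  joinList-upper {xs = y ∷ xs} (here refl) = x≤x∨y _ _
  joinList-upper {xs = y ∷ xs} (there x∈) = ≤-trans (joinList-upper x∈) (y≤x∨y _ _)

  joinList-least : ∀ {u} xs → (∀ {x} → x ∈ₗ xs → x ≤ u) → joinList L xs ≤ u
  joinList-least {u} [] _ = minimum u
  joinList-least (x ∷ xs) bound = ∨-least (bound (here refl)) (joinList-least xs (bound ∘ there))

  ⋁-upper : ∀ {A a} → a ∈ A → a ≤ ⋁ L A
  ⋁-upper {A} {a} a∈A = joinList-upper (∈-filter⁺ (_∈? A) (∈-allFin a) a∈A)

  ⋁-least : ∀ A {u} → (∀ {a} → a ∈ A → a ≤ u) → ⋁ L A ≤ u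
  ⋁-least A bound = joinList-least _ (bound ∘ proj₂ ∘ ∈-filter⁻ (_∈? A) {xs = allFin n})

  ⋁≤⊎∃≰ : ∀ A u → ⋁ L A ≤ u ⊎ ∃ λ a → a ∈ A × ¬ a ≤ u
  ⋁≤⊎∃≰ A u with any? (λ a → (a ∈? A) ×-dec ¬? (a ≤? u))
  ... | yes witness = inj₂ witness
  ... | no none = inj₁ (⋁-least A λ {a} a∈A → decidable-stable (a ≤? u) (λ a≰u → none (a , a∈A , a≰u)))

  ⋁-⁅x⁆ : ∀ x → ⋁ L ⁅ x ⁆ ≡ x
  ⋁-⁅x⁆ x = antisym (⋁-least ⁅ x ⁆ (reflexive ∘ x∈⁅y⁆⇒x≡y x)) (⋁-upper (x∈⁅x⁆ x))

  ⋁-⁅x⁆∪⁅y⁆ : ∀ x y → ⋁ L (⁅ x ⁆ ∪ ⁅ y ⁆) ≡ x ∨ y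
  ⋁-⁅x⁆∪⁅y⁆ x y = antisym (⋁-least _ (⁅x⁆∪⁅y⁆-elim (_≤ x ∨ y) (x≤x∨y x y) (y≤x∨y x y)))
                          (∨-least (⋁-upper (x∈⁅x⁆∪⁅y⁆ x y)) (⋁-upper (y∈⁅x⁆∪⁅y⁆ x y)))

  ⋁-⊂⁅x⁆∪⁅y⁆ : ∀ {C x y} → C ⊂ ⁅ x ⁆ ∪ ⁅ y ⁆ → ⋁ L C ≤ x ⊎ ⋁ L C ≤ y
  ⋁-⊂⁅x⁆∪⁅y⁆ {C} {x} {y} (C⊆ , m , m∈ , m∉C) with x∈p∪q⁻ ⁅ x ⁆ ⁅ y ⁆ m∈
  ... | inj₁ m∈⁅x⁆ = inj₂ (⋁-least C λ c∈ →
                       ⁅x⁆∪⁅y⁆-elim (λ c → c ∈ C → c ≤ y) (⊥-elim ∘ x∉C) (λ _ → ≤-refl) (C⊆ c∈) c∈)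
    where x∉C : x ∉ C
          x∉C = subst (_∉ C) (x∈⁅y⁆⇒x≡y x m∈⁅x⁆) m∉C
  ... | inj₂ m∈⁅y⁆ = inj₁ (⋁-least C λ c∈ →
                       ⁅x⁆∪⁅y⁆-elim (λ c → c ∈ C → c ≤ x) (λ _ → ≤-refl) (⊥-elim ∘ y∉C) (C⊆ c∈) c∈)
    where y∉C : y ∉ C
          y∉C = subst (_∉ C) (x∈⁅y⁆⇒x≡y y m∈⁅y⁆) m∉C

  pair-irredundant : ∀ {x y z} → z ≤ x ∨ y → ¬ z ≤ x → ¬ z ≤ y → Irredundant L (⁅ x ⁆ ∪ ⁅ y ⁆)
  pair-irredundant {x} {y} {z} z≤x∨y z≰x z≰y C C⊂ ⋁C≡ =
    [ z≰x ∘ ≤-trans z≤⋁C , z≰y ∘ ≤-trans z≤⋁C ]′ (⋁-⊂⁅x⁆∪⁅y⁆ C⊂)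
    where z≤⋁C : z ≤ ⋁ L C
          z≤⋁C = subst (z ≤_) (sym (trans ⋁C≡ (⋁-⁅x⁆∪⁅y⁆ x y))) z≤x∨y

  pair-irredundant⇒≰ : ∀ {x y} → Irredundant L (⁅ x ⁆ ∪ ⁅ y ⁆) → x ≢ y → ¬ x ≤ y
  pair-irredundant⇒≰ {x} {y} irr x≢y x≤y =
    irr ⁅ y ⁆ (q⊆p∪q ⁅ x ⁆ ⁅ y ⁆ , x , x∈⁅x⁆∪⁅y⁆ x y , x≢y ∘ x∈⁅y⁆⇒x≡y y)
        (trans (⋁-⁅x⁆ y) (trans (sym (x≤y⇒x∨y≡y x≤y)) (sym (⋁-⁅x⁆∪⁅y⁆ x y))))

  -- {y, z} would be an irredundant representation of ⋁{x, y} not refined by the face {x, y}.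
  face-pair⇒≰∨lower : ∀ {x y z} → IsFace L (⁅ x ⁆ ∪ ⁅ y ⁆) → x ≢ y → z ≤ x → ¬ x ≤ z → ¬ x ≤ y ∨ z
  face-pair⇒≰∨lower {x} {y} {z} (_ , irr , refines) x≢y z≤x x≰z x≤y∨z
    with refines (⁅ y ⁆ ∪ ⁅ z ⁆) same-join (pair-irredundant x≤y∨z x≰y x≰z) x (x∈⁅x⁆∪⁅y⁆ x y)
    where
    x≰y : ¬ x ≤ y
    x≰y = pair-irredundant⇒≰ irr x≢y
    same-join : ⋁ L (⁅ y ⁆ ∪ ⁅ z ⁆) ≡ ⋁ L (⁅ x ⁆ ∪ ⁅ y ⁆)
    same-join = trans (⋁-⁅x⁆∪⁅y⁆ y z) (trans y∨z≡x∨y (sym (⋁-⁅x⁆∪⁅y⁆ x y)))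
      where y∨z≡x∨y = antisym (∨-least (y≤x∨y x y) (≤-trans z≤x (x≤x∨y x y)))
                              (∨-least x≤y∨z (x≤x∨y y z))
  ... | b , b∈ , x≤b = ⁅x⁆∪⁅y⁆-elim (λ b → ¬ x ≤ b) (pair-irredundant⇒≰ irr x≢y) x≰z b∈ x≤b

  Maximal : (Fin n → Set) → Fin n → Set
  Maximal P m = P m × (∀ a → P a → m ≤ a → a ≡ m)

  maximal-above : ∀ {P} → (∀ x → Dec (P x)) → ∀ {x} → P x → Σ (Fin n) λ m → x ≤ m × Maximal P m
  maximal-above {P} P? = go (po-noetherian isPartialOrder _)
    where
    go : ∀ {x} → Acc (λ a b → b ≤ a × b ≢ a) x → P x → Σ (Fin n) λ m → x ≤ m × Maximal P m
    go {x} (acc larger) Px with any? (λ a → P? a ×-dec (x ≤? a) ×-dec ¬? (x ≟ a))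
    ... | yes (a , Pa , x≤a , x≢a) = let m , a≤m , max = go (larger (x≤a , x≢a)) Pa
                                     in m , ≤-trans x≤a a≤m , max
    ... | no none = x , ≤-refl , Px , λ a Pa x≤a →
                      decidable-stable (a ≟ x) (λ a≢x → none (a , Pa , x≤a , a≢x ∘ sym))

  lowerCover-≤ : ∀ {j} (ji : JoinIrreducible L j) → proj₁ ji ≤ j
  lowerCover-≤ (_ , ((j*≤j , _) , _) , _) = j*≤j

  ≰lowerCover : ∀ {j} (ji : JoinIrreducible L j) → ¬ j ≤ proj₁ ji
  ≰lowerCover (_ , ((j*≤j , j*≢j) , _) , _) j≤j* = j*≢j (antisym j*≤j j≤j*)

  -- A maximal element strictly below j is covered by j, hence it is j_*.
  <⇒≤lowerCover : ∀ {j z} (ji : JoinIrreducible L j) → z ≤ j → z ≢ j → z ≤ proj₁ ji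
  <⇒≤lowerCover {j} (j* , _ , unique) z≤j z≢j
    with maximal-above (λ a → (a ≤? j) ×-dec ¬? (a ≟ j)) (z≤j , z≢j)
  ... | m , z≤m , m<j , max = subst (_ ≤_) (unique m (m<j , nothing-between)) z≤m
    where nothing-between : ∀ a → _<_ L m a → _<_ L a j → _
          nothing-between a (m≤a , m≢a) a<j = m≢a (sym (max a a<j m≤a))

  𝒦? : ∀ j ji a → Dec (𝒦 L j ji a)
  𝒦? j (j* , _) a = (j* ≤? a) ×-dec ¬? (j ≤? a)

  KappaExists? : ∀ j ji → Dec (KappaExists L j ji)
  KappaExists? j ji = any? λ m → Maximal? m ×-dec all? (λ m' → Maximal? m' →-dec (m' ≟ m))
    where Maximal? : ∀ m → Dec (Maximal (𝒦 L j ji) m)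
          Maximal? m = 𝒦? j ji m ×-dec all? (λ a → 𝒦? j ji a →-dec (m ≤? a) →-dec (a ≟ m))

  𝒦⇒≤κ : ∀ {j ji z} (κ : KappaExists L j ji) → 𝒦 L j ji z → z ≤ proj₁ κ
  𝒦⇒≤κ {j} {ji} (κ , _ , unique) z∈𝒦 with maximal-above (𝒦? j ji) z∈𝒦
  ... | m , z≤m , max = subst (_ ≤_) (unique m max) z≤m

  module _ (jsd : JoinSemidistributive L) {j} (ji : JoinIrreducible L j) (κj : KappaExists L j ji) where
    private
      κ = proj₁ κj
      j* = proj₁ ji

    κ∈𝒦 : 𝒦 L j ji κ
    κ∈𝒦 = proj₁ (proj₁ (proj₂ κj))

    j*≤z⇒j≤z⊎z≤κ∧w : ∀ {z w} → j* ≤ z → z ≤ w → j ≤ z ⊎ z ≤ κ ∧ w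
    j*≤z⇒j≤z⊎z≤κ∧w {z} j*≤z z≤w with j ≤? z
    ... | yes j≤z = inj₁ j≤z
    ... | no j≰z = inj₂ (∧-greatest (𝒦⇒≤κ {ji = ji} κj (j*≤z , j≰z)) z≤w)

    module _ {w} (j≤w : j ≤ w) (y∨j≡w : (κ ∧ w) ∨ j ≡ w) where
      private
        y = κ ∧ w

      j*≤κ∧w : j* ≤ y
      j*≤κ∧w = ∧-greatest (proj₁ κ∈𝒦) (≤-trans (lowerCover-≤ ji) j≤w)

      j≰κ∧w : ¬ j ≤ y
      j≰κ∧w j≤y = proj₂ κ∈𝒦 (≤-trans j≤y (x∧y≤x κ w))

      b≰κ∧w⇒κ∧w∨b≡w : ∀ {b} → b ≤ w → ¬ b ≤ y → y ∨ b ≡ w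
      b≰κ∧w⇒κ∧w∨b≡w {b} b≤w b≰y
        with j*≤z⇒j≤z⊎z≤κ∧w (≤-trans j*≤κ∧w (x≤x∨y y b)) (∨-least (x∧y≤y κ w) b≤w)
      ... | inj₁ j≤y∨b = antisym (∨-least (x∧y≤y κ w) b≤w)
                                 (subst (_≤ y ∨ b) y∨j≡w (∨-least (x≤x∨y y b) j≤y∨b))
      ... | inj₂ y∨b≤y = ⊥-elim (b≰y (≤-trans (y≤x∨y y b) y∨b≤y))

      -- By join-semidistributivity y ∨ (j ∧ b) = w, while j ∧ b < j would give y ∨ (j ∧ b) = y.
      member-above : ∀ B → ⋁ L B ≡ w → ∃ λ b → b ∈ B × j ≤ b
      member-above B ⋁B≡w with ⋁≤⊎∃≰ B y
      ... | inj₁ ⋁B≤y = ⊥-elim (j≰κ∧w (≤-trans j≤w (subst (_≤ y) ⋁B≡w ⋁B≤y)))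
      ... | inj₂ (b , b∈B , b≰y) with j ≤? b
      ...   | yes j≤b = b , b∈B , j≤b
      ...   | no j≰b = ⊥-elim (j≰κ∧w (≤-trans (y≤x∨y y j) (subst (_≤ y) y∨[j∧b]≡y∨j y∨[j∧b]≤y)))
        where
        b≤w : b ≤ w
        b≤w = subst (b ≤_) ⋁B≡w (⋁-upper b∈B)
        y∨[j∧b]≡y∨j : y ∨ (j ∧ b) ≡ y ∨ j
        y∨[j∧b]≡y∨j = jsd y j b (trans y∨j≡w (sym (b≰κ∧w⇒κ∧w∨b≡w b≤w b≰y)))
        j∧b≢j : j ∧ b ≢ j
        j∧b≢j j∧b≡j = j≰b (subst (_≤ b) j∧b≡j (x∧y≤y j b))
        y∨[j∧b]≤y : y ∨ (j ∧ b) ≤ y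
        y∨[j∧b]≤y = ∨-least ≤-refl (≤-trans (<⇒≤lowerCover ji (x∧y≤x j b) j∧b≢j) j*≤κ∧w)

  module _ (jsd : JoinSemidistributive L) {F : Subset n} (ji : ∀ j → j ∈ F → JoinIrreducible L j)
           (pairs-are-faces : ∀ {x y} → x ∈ F → y ∈ F → IsFace L (⁅ x ⁆ ∪ ⁅ y ⁆))
           (κ : ∀ j j∈F → KappaExists L j (ji j j∈F)) where

    ∈F⇒≤κ : ∀ {j a} (j∈F : j ∈ F) → a ∈ F → a ≢ j → a ≤ proj₁ (κ j j∈F)
    ∈F⇒≤κ {j} {a} j∈F a∈F a≢j =
      ≤-trans (x≤x∨y a j*) (𝒦⇒≤κ {ji = ji j j∈F} (κ j j∈F) (y≤x∨y a j* , j≰a∨j*))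
      where
      j* = proj₁ (ji j j∈F)
      j≰a∨j* : ¬ j ≤ a ∨ j*
      j≰a∨j* = face-pair⇒≰∨lower (pairs-are-faces j∈F a∈F) (a≢j ∘ sym)
                                  (lowerCover-≤ (ji j j∈F)) (≰lowerCover (ji j j∈F))

    κ∧⋁F∨j≡⋁F : ∀ {j} (j∈F : j ∈ F) → (proj₁ (κ j j∈F) ∧ ⋁ L F) ∨ j ≡ ⋁ L F
    κ∧⋁F∨j≡⋁F {j} j∈F = antisym (∨-least (x∧y≤y _ _) (⋁-upper j∈F)) (⋁-least F below)
      where
      below : ∀ {a} → a ∈ F → a ≤ (proj₁ (κ j j∈F) ∧ ⋁ L F) ∨ j
      below {a} a∈F with a ≟ j
      ... | yes refl = y≤x∨y _ _
      ... | no a≢j = ≤-trans (∧-greatest (∈F⇒≤κ j∈F a∈F a≢j) (⋁-upper a∈F)) (x≤x∨y _ _)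

    irredundant⇒face : Irredundant L F → IsFace L F
    irredundant⇒face irr = refl , irr , λ B ⋁B≡⋁F _ j j∈F →
      member-above jsd (ji j j∈F) (κ j j∈F) (⋁-upper j∈F) (κ∧⋁F∨j≡⋁F j∈F) B ⋁B≡⋁F

  κ-missing⊎κ-exists : ∀ {F : Subset n} (ji : ∀ j → j ∈ F → JoinIrreducible L j) →
    (Σ _ λ j → Σ (j ∈ F) λ j∈F → ¬ KappaExists L j (ji j j∈F)) ⊎ (∀ j j∈F → KappaExists L j (ji j j∈F))
  κ-missing⊎κ-exists {F} ji with any? κ-missing?
    where
    κ-missing? : ∀ j → Dec (Σ (j ∈ F) λ j∈F → ¬ KappaExists L j (ji j j∈F))
    κ-missing? j with j ∈? F
    ... | no j∉F = no (j∉F ∘ proj₁)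
    ... | yes j∈F = map′ (j∈F ,_)
                         (λ (j∈F′ , ¬κ) → subst (λ p → ¬ KappaExists L j (ji j p)) (∈-irrelevant j∈F′ j∈F) ¬κ)
                         (¬? (KappaExists? j (ji j j∈F)))
  ... | yes missing = inj₁ missing
  ... | no none = inj₂ λ j j∈F → decidable-stable (KappaExists? j (ji j j∈F)) (λ ¬κ → none (j , j∈F , ¬κ))

open FinLatticeProperties

lemma3p9 : {n : ℕ} (L : FinLattice n) → JoinSemidistributive L →
    (F : Subset n) →
    (ji : ∀ j → j ∈ F → JoinIrreducible L j) →
    ∣ F ∣ ≥ 3 →
    (∀ B → B ⊂ F → IsFace L B) →
    Irredundant L F →
    ¬ IsFace L F →
    Σ _ λ j → Σ (j ∈ F) λ j∈F → ¬ KappaExists L j (ji j j∈F)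
lemma3p9 L jsd F ji 3≤∣F∣ proper-faces irr ¬face with κ-missing⊎κ-exists L ji
... | inj₁ missing = missing
... | inj₂ κ = ⊥-elim (¬face (irredundant⇒face L jsd ji pairs-are-faces κ irr))
  where pairs-are-faces : ∀ {x y} → x ∈ F → y ∈ F → IsFace L (⁅ x ⁆ ∪ ⁅ y ⁆)
        pairs-are-faces x∈F y∈F = proper-faces _ (⁅x⁆∪⁅y⁆⊂ 3≤∣F∣ x∈F y∈F)
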